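{- Let $G,H\in\mathbb{GS}$. Then $Ls(G+X)\ge Ls(H+X)$ for all $X\in\mathbb{GS}$ if and only if $Rs(G+Y)\ge Rs(H+Y)$ for all $Y\in\mathbb{GS}$.
   Context: A scoring game is written $G=\langle G^{\mathcal L}\mid G^{\mathcal R}\rangle$, where each of $G^{\mathcal L}$ (Left options) and $G^{\mathcal R}$ (Right options) is either a finite nonempty set of scoring games or an atom $\emptyset^{s}$, $s\in\mathbb R$ (the player to move on that side cannot move and the game ends with score $s$); game trees are finite. An atom occurring in $G$ is an atom of $G$ or of any follower of $G$. $G$ is guaranteed if for every follower $K$ of $G$: if $K^{\mathcal L}=\emptyset^\ell$ then $\ell\le s$ for every atom $\emptyset^s$ occurring in $K$, and if $K^{\mathcal R}=\emptyset^r$ then $s\le r$ for every atom $\emptyset^s$ occurring in $K$; $\mathbb{GS}$ is the class of guaranteed games. Disjunctive sum $G+H$: Left options are $G^L+H$ and $G+H^L$, except if both are left-atomic with atoms $\emptyset^{\ell_1},\emptyset^{\ell_2}$, then $(G+H)^{\mathcal L}=\emptyset^{\ell_1+\ell_2}$; Right symmetric. Stops: $Ls(G)=\ell$ if $G^{\mathcal L}=\emptyset^\ell$, otherwise $\max_{G^L}Rs(G^L)$; $Rs(G)=r$ if $G^{\mathcal R}=\emptyset^r$, otherwise $\min_{G^R}Ls(G^R)$. -}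

module Defs where

open import Level using (0ℓ)
open import Data.Nat using (ℕ; suc) renaming (_+_ to _+ℕ_)
open import Data.Fin using (Fin; zero; suc; splitAt)
open import Data.Sum using (_⊎_; inj₁; inj₂; [_,_]′)
open import Data.Product using (Σ; _×_; _,_)
open import Data.Empty using (⊥)
open import Relation.Nullary using (¬_)
open import Relation.Binary.PropositionalEquality using (_≡_)
open import Relation.Binary.Structures using (IsTotalOrder)
open import Algebra.Structures using (IsCommutativeRing)

-- The real numbers, axiomatised as a complete ordered field
-- (unique up to isomorphism, so quantifying over all of them is
-- quantifying over ℝ).

record CompleteOrderedField : Set₁ where
  infixl 6 _+_
  infixl 7 _*_
  infix  4 _≤_
  field
    Carrier : Set
    _+_ _*_ : Carrier → Carrier → Carrier
    -_      : Carrier → Carrier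
    0# 1#   : Carrier
    _≤_     : Carrier → Carrier → Set
    isCommutativeRing : IsCommutativeRing _≡_ _+_ _*_ -_ 0# 1#
    0≢1     : ¬ (0# ≡ 1#)
    inverse : ∀ x → ¬ (x ≡ 0#) → Σ Carrier (λ y → x * y ≡ 1#)
    isTotalOrder : IsTotalOrder _≡_ _≤_
    +-mono-≤ : ∀ {x y} z → x ≤ y → x + z ≤ y + z
    *-nonneg : ∀ {x y} → 0# ≤ x → 0# ≤ y → 0# ≤ x * y
    complete : (P : Carrier → Set) → Σ Carrier P →
               Σ Carrier (λ b → ∀ x → P x → x ≤ b) →
               Σ Carrier (λ s → (∀ x → P x → x ≤ s) ×
                                (∀ b → (∀ x → P x → x ≤ b) → s ≤ b))

  open IsTotalOrder isTotalOrder public using (total)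

  max min : Carrier → Carrier → Carrier
  max x y = [ (λ _ → y) , (λ _ → x) ]′ (total x y)
  min x y = [ (λ _ → x) , (λ _ → y) ]′ (total x y)

module Games (ℝ : CompleteOrderedField) where
  open CompleteOrderedField ℝ

  mutual
    -- One side of a game: either an atom ∅^s, or a finite nonempty
    -- family of options (indexed by Fin (suc n)).
    data Side : Set where
      atom : Carrier → Side
      opts : (n : ℕ) → (Fin (suc n) → Game) → Side

    data Game : Set where
      ⟨_∣_⟩ : Side → Side → Game

  leftSide rightSide : Game → Side
  leftSide  ⟨ L ∣ _ ⟩ = L
  rightSide ⟨ _ ∣ R ⟩ = R

  data IsOptionOf : Game → Side → Set where
    here : ∀ {n f} (i : Fin (suc n)) → IsOptionOf (f i) (opts n f)

  data Option : Game → Game → Set where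
    left  : ∀ {K L R} → IsOptionOf K L → Option K ⟨ L ∣ R ⟩
    right : ∀ {K L R} → IsOptionOf K R → Option K ⟨ L ∣ R ⟩

  data Follower : Game → Game → Set where
    self : ∀ {G} → Follower G G
    step : ∀ {K K' G} → Option K' G → Follower K K' → Follower K G

  data Occurs (s : Carrier) : Game → Set where
    atomL : ∀ {R} → Occurs s ⟨ atom s ∣ R ⟩
    atomR : ∀ {L} → Occurs s ⟨ L ∣ atom s ⟩
    inOpt : ∀ {K G} → Option K G → Occurs s K → Occurs s G

  Guaranteed : Game → Set
  Guaranteed G = ∀ K → Follower K G →
      (∀ ℓ → leftSide K ≡ atom ℓ → ∀ s → Occurs s K → ℓ ≤ s)
    × (∀ r → rightSide K ≡ atom r → ∀ s → Occurs s K → s ≤ r)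

  infixl 6 _⊕_
  mutual
    _⊕_ : Game → Game → Game
    G ⊕ H = ⟨ sumL G H ∣ sumR G H ⟩

    sumL : Game → Game → Side
    sumL ⟨ atom a ∣ _ ⟩ ⟨ atom b ∣ _ ⟩ = atom (a + b)
    sumL ⟨ opts n f ∣ _ ⟩ H@(⟨ atom _ ∣ _ ⟩) = opts n (λ i → f i ⊕ H)
    sumL G@(⟨ atom _ ∣ _ ⟩) ⟨ opts m g ∣ _ ⟩ = opts m (λ j → G ⊕ g j)
    sumL G@(⟨ opts n f ∣ _ ⟩) H@(⟨ opts m g ∣ _ ⟩) =
      opts (n +ℕ suc m)
        (λ k → [ (λ i → f i ⊕ H) , (λ j → G ⊕ g j) ]′ (splitAt (suc n) k))

    sumR : Game → Game → Side
    sumR ⟨ _ ∣ atom a ⟩ ⟨ _ ∣ atom b ⟩ = atom (a + b)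
    sumR ⟨ _ ∣ opts n f ⟩ H@(⟨ _ ∣ atom _ ⟩) = opts n (λ i → f i ⊕ H)
    sumR G@(⟨ _ ∣ atom _ ⟩) ⟨ _ ∣ opts m g ⟩ = opts m (λ j → G ⊕ g j)
    sumR G@(⟨ _ ∣ opts n f ⟩) H@(⟨ _ ∣ opts m g ⟩) =
      opts (n +ℕ suc m)
        (λ k → [ (λ i → f i ⊕ H) , (λ j → G ⊕ g j) ]′ (splitAt (suc n) k))

  maxF minF : (n : ℕ) → (Fin (suc n) → Carrier) → Carrier
  maxF ℕ.zero    v = v zero
  maxF (suc n) v = max (v zero) (maxF n (λ i → v (suc i)))
  minF ℕ.zero    v = v zero
  minF (suc n) v = min (v zero) (minF n (λ i → v (suc i)))

  mutual
    Ls : Game → Carrier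
    Ls ⟨ atom ℓ ∣ _ ⟩ = ℓ
    Ls ⟨ opts n f ∣ _ ⟩ = maxF n (λ i → Rs (f i))

    Rs : Game → Carrier
    Rs ⟨ _ ∣ atom r ⟩ = r
    Rs ⟨ _ ∣ opts n f ⟩ = minF n (λ i → Ls (f i))

-- Left's probe X = {Y | c} lets Left move to Y, so Ls(H + X) ≥ Rs(H + Y).
-- Any Left move G^L in G + X is answered by Right moving X to the constant
-- game c, worth Ls(G^L) + c to Left; taking c = Rs(G + Y) − max Ls(G^L)
-- gives Ls(G + X) ≤ Rs(G + Y). Hence Ls(H + X) ≤ Ls(G + X) for all X
-- forces Rs(H + Y) ≤ Rs(G + Y); the converse uses the mirror-image probe
-- {c | X}. Only the probes need to be guaranteed, not G and H.
module Submission where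

open import Defs
open import Level using (0ℓ)
open import Data.Nat using (suc) renaming (_+_ to _+ℕ_)
open import Data.Fin using (Fin; zero; suc; splitAt; _↑ʳ_)
open import Data.Fin.Properties using (splitAt-↑ʳ)
open import Data.Product using (_×_; _,_)
open import Data.Sum using (_⊎_; inj₁; inj₂; [_,_]′)
open import Relation.Binary.PropositionalEquality using (_≡_; refl; cong; cong₂)
open import Relation.Binary.Bundles using (TotalOrder)
open import Algebra.Bundles using (CommutativeRing)
open import Algebra.Construct.NaturalChoice.Base using (MinOperator; MaxOperator)
import Algebra.Construct.NaturalChoice.MinOp as MinOp
import Algebra.Construct.NaturalChoice.MaxOp as MaxOp
import Algebra.Properties.Group as GroupProperties
import Relation.Binary.Reasoning.PartialOrder as ≤-Reasoning

module ScoringGames (ℝ : CompleteOrderedField) where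
  open CompleteOrderedField ℝ
  open Games ℝ

  ≤-totalOrder : TotalOrder 0ℓ 0ℓ 0ℓ
  ≤-totalOrder = record { isTotalOrder = isTotalOrder }

  ring : CommutativeRing 0ℓ 0ℓ
  ring = record { isCommutativeRing = isCommutativeRing }

  open TotalOrder ≤-totalOrder using (totalPreorder; poset; antisym)
    renaming (refl to ≤-refl)
  open GroupProperties (CommutativeRing.+-group ring) using (\\-leftDividesˡ)
  open ≤-Reasoning poset

  minOperator : MinOperator totalPreorder
  minOperator = record
    { _⊓_       = min
    ; x≤y⇒x⊓y≈x = λ {x} {y} x≤y → min-left x y x≤y (total x y)
    ; x≥y⇒x⊓y≈y = λ {x} {y} y≤x → min-right x y y≤x (total x y)
    }
    where
    min-left : ∀ x y → x ≤ y → (e : x ≤ y ⊎ y ≤ x) → [ (λ _ → x) , (λ _ → y) ]′ e ≡ x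
    min-left x y _   (inj₁ _)   = refl
    min-left x y x≤y (inj₂ y≤x) = antisym y≤x x≤y
    min-right : ∀ x y → y ≤ x → (e : x ≤ y ⊎ y ≤ x) → [ (λ _ → x) , (λ _ → y) ]′ e ≡ y
    min-right x y y≤x (inj₁ x≤y) = antisym x≤y y≤x
    min-right x y _   (inj₂ _)   = refl

  maxOperator : MaxOperator totalPreorder
  maxOperator = record
    { _⊔_       = max
    ; x≤y⇒x⊔y≈y = λ {x} {y} x≤y → max-right x y x≤y (total x y)
    ; x≥y⇒x⊔y≈x = λ {x} {y} y≤x → max-left x y y≤x (total x y)
    }
    where
    max-right : ∀ x y → x ≤ y → (e : x ≤ y ⊎ y ≤ x) → [ (λ _ → y) , (λ _ → x) ]′ e ≡ y
    max-right x y _   (inj₁ _)   = refl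
    max-right x y x≤y (inj₂ y≤x) = antisym x≤y y≤x
    max-left : ∀ x y → y ≤ x → (e : x ≤ y ⊎ y ≤ x) → [ (λ _ → y) , (λ _ → x) ]′ e ≡ x
    max-left x y y≤x (inj₁ x≤y) = antisym y≤x x≤y
    max-left x y _   (inj₂ _)   = refl

  open MinOp minOperator using (x⊓y≤x; x≤y⇒z⊓x≤y; ⊓-glb; mono-≤-distrib-⊓)
  open MaxOp maxOperator using (x≤x⊔y; x≤y⇒x≤z⊔y; ⊔-lub; mono-≤-distrib-⊔)

  maxF-ub : ∀ n (v : Fin (suc n) → Carrier) i → v i ≤ maxF n v
  maxF-ub 0       v zero    = ≤-refl
  maxF-ub (suc n) v zero    = x≤x⊔y _ _
  maxF-ub (suc n) v (suc i) = x≤y⇒x≤z⊔y (v zero) (maxF-ub n (λ i → v (suc i)) i)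

  maxF-lub : ∀ n (v : Fin (suc n) → Carrier) {b} → (∀ i → v i ≤ b) → maxF n v ≤ b
  maxF-lub 0       v v≤b = v≤b zero
  maxF-lub (suc n) v v≤b = ⊔-lub (v≤b zero) (maxF-lub n (λ i → v (suc i)) (λ i → v≤b (suc i)))

  minF-lb : ∀ n (v : Fin (suc n) → Carrier) i → minF n v ≤ v i
  minF-lb 0       v zero    = ≤-refl
  minF-lb (suc n) v zero    = x⊓y≤x _ _
  minF-lb (suc n) v (suc i) = x≤y⇒z⊓x≤y (v zero) (minF-lb n (λ i → v (suc i)) i)

  minF-glb : ∀ n (v : Fin (suc n) → Carrier) {b} → (∀ i → b ≤ v i) → b ≤ minF n v
  minF-glb 0       v b≤v = b≤v zero
  minF-glb (suc n) v b≤v = ⊓-glb (b≤v zero) (minF-glb n (λ i → v (suc i)) (λ i → b≤v (suc i)))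

  maxF-shift : ∀ n (v w : Fin (suc n) → Carrier) c → (∀ i → w i ≡ v i + c) →
               maxF n w ≡ maxF n v + c
  maxF-shift 0       v w c w≡v+c = w≡v+c zero
  maxF-shift (suc n) v w c w≡v+c = begin-equality
    max (w zero) (maxF n (λ i → w (suc i)))
      ≡⟨ cong₂ max (w≡v+c zero) (maxF-shift n _ _ c (λ i → w≡v+c (suc i))) ⟩
    max (v zero + c) (maxF n (λ i → v (suc i)) + c)
      ≡⟨ mono-≤-distrib-⊔ (cong (_+ c)) (+-mono-≤ c) _ _ ⟨
    max (v zero) (maxF n (λ i → v (suc i))) + c ∎

  minF-shift : ∀ n (v w : Fin (suc n) → Carrier) c → (∀ i → w i ≡ v i + c) →
               minF n w ≡ minF n v + c
  minF-shift 0       v w c w≡v+c = w≡v+c zero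
  minF-shift (suc n) v w c w≡v+c = begin-equality
    min (w zero) (minF n (λ i → w (suc i)))
      ≡⟨ cong₂ min (w≡v+c zero) (minF-shift n _ _ c (λ i → w≡v+c (suc i))) ⟩
    min (v zero + c) (minF n (λ i → v (suc i)) + c)
      ≡⟨ mono-≤-distrib-⊓ (cong (_+ c)) (+-mono-≤ c) _ _ ⟨
    min (v zero) (minF n (λ i → v (suc i))) + c ∎

  constant : Carrier → Game
  constant c = ⟨ atom c ∣ atom c ⟩

  mutual
    Ls-⊕-constant : ∀ c K → Ls (K ⊕ constant c) ≡ Ls K + c
    Ls-⊕-constant c ⟨ atom ℓ ∣ _ ⟩   = refl
    Ls-⊕-constant c ⟨ opts n f ∣ _ ⟩ =
      maxF-shift n (λ i → Rs (f i)) _ c (λ i → Rs-⊕-constant c (f i))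

    Rs-⊕-constant : ∀ c K → Rs (K ⊕ constant c) ≡ Rs K + c
    Rs-⊕-constant c ⟨ _ ∣ atom r ⟩   = refl
    Rs-⊕-constant c ⟨ _ ∣ opts n f ⟩ =
      minF-shift n (λ i → Ls (f i)) _ c (λ i → Ls-⊕-constant c (f i))

  Ls-⊕-ub : ∀ K {m g R} j → Rs (K ⊕ g j) ≤ Ls (K ⊕ ⟨ opts m g ∣ R ⟩)
  Ls-⊕-ub ⟨ atom _ ∣ _ ⟩ {m} j = maxF-ub m _ j
  Ls-⊕-ub K@(⟨ opts n f ∣ _ ⟩) {m} {g} {R} j = begin
    Rs (K ⊕ g j)
      ≡⟨ cong (λ e → Rs ([ (λ i → f i ⊕ X) , (λ j → K ⊕ g j) ]′ e)) (splitAt-↑ʳ (suc n) (suc m) j) ⟨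
    Rs ([ (λ i → f i ⊕ X) , (λ j → K ⊕ g j) ]′ (splitAt (suc n) (suc n ↑ʳ j)))
      ≤⟨ maxF-ub (n +ℕ suc m) _ (suc n ↑ʳ j) ⟩
    Ls (K ⊕ X) ∎
    where X = ⟨ opts m g ∣ R ⟩

  Ls-⊕-lub : ∀ K {m g R b} →
             (∀ {K′} → IsOptionOf K′ (leftSide K) → Rs (K′ ⊕ ⟨ opts m g ∣ R ⟩) ≤ b) →
             (∀ j → Rs (K ⊕ g j) ≤ b) → Ls (K ⊕ ⟨ opts m g ∣ R ⟩) ≤ b
  Ls-⊕-lub ⟨ atom _ ∣ _ ⟩ {m} _ moveX = maxF-lub m _ moveX
  Ls-⊕-lub K@(⟨ opts n f ∣ _ ⟩) {m} {g} {R} {b} moveK moveX =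
    maxF-lub (n +ℕ suc m) _ (λ k → bySide (splitAt (suc n) k))
    where
    bySide : (e : Fin (suc n) ⊎ Fin (suc m)) →
             Rs ([ (λ i → f i ⊕ ⟨ opts m g ∣ R ⟩) , (λ j → K ⊕ g j) ]′ e) ≤ b
    bySide (inj₁ i) = moveK (here i)
    bySide (inj₂ j) = moveX j

  Rs-⊕-lb : ∀ K {m g L} j → Rs (K ⊕ ⟨ L ∣ opts m g ⟩) ≤ Ls (K ⊕ g j)
  Rs-⊕-lb ⟨ _ ∣ atom _ ⟩ {m} j = minF-lb m _ j
  Rs-⊕-lb K@(⟨ _ ∣ opts n f ⟩) {m} {g} {L} j = begin
    Rs (K ⊕ X)
      ≤⟨ minF-lb (n +ℕ suc m) _ (suc n ↑ʳ j) ⟩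
    Ls ([ (λ i → f i ⊕ X) , (λ j → K ⊕ g j) ]′ (splitAt (suc n) (suc n ↑ʳ j)))
      ≡⟨ cong (λ e → Ls ([ (λ i → f i ⊕ X) , (λ j → K ⊕ g j) ]′ e)) (splitAt-↑ʳ (suc n) (suc m) j) ⟩
    Ls (K ⊕ g j) ∎
    where X = ⟨ L ∣ opts m g ⟩

  Rs-⊕-glb : ∀ K {m g L b} →
             (∀ {K′} → IsOptionOf K′ (rightSide K) → b ≤ Ls (K′ ⊕ ⟨ L ∣ opts m g ⟩)) →
             (∀ j → b ≤ Ls (K ⊕ g j)) → b ≤ Rs (K ⊕ ⟨ L ∣ opts m g ⟩)
  Rs-⊕-glb ⟨ _ ∣ atom _ ⟩ {m} _ moveX = minF-glb m _ moveX
  Rs-⊕-glb K@(⟨ _ ∣ opts n f ⟩) {m} {g} {L} {b} moveK moveX =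
    minF-glb (n +ℕ suc m) _ (λ k → bySide (splitAt (suc n) k))
    where
    bySide : (e : Fin (suc n) ⊎ Fin (suc m)) →
             b ≤ Ls ([ (λ i → f i ⊕ ⟨ L ∣ opts m g ⟩) , (λ j → K ⊕ g j) ]′ e)
    bySide (inj₁ i) = moveK (here i)
    bySide (inj₂ j) = moveX j

  constant-guaranteed : ∀ c → Guaranteed (constant c)
  constant-guaranteed c _ self = atomsAbove , atomsBelow
    where
    atomsAbove : ∀ ℓ → atom c ≡ atom ℓ → ∀ s → Occurs s (constant c) → ℓ ≤ s
    atomsAbove _ refl _ atomL                 = ≤-refl
    atomsAbove _ refl _ atomR                 = ≤-refl
    atomsAbove _ refl _ (inOpt (left ()) _)
    atomsAbove _ refl _ (inOpt (right ()) _)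
    atomsBelow : ∀ r → atom c ≡ atom r → ∀ s → Occurs s (constant c) → s ≤ r
    atomsBelow _ refl _ atomL                 = ≤-refl
    atomsBelow _ refl _ atomR                 = ≤-refl
    atomsBelow _ refl _ (inOpt (left ()) _)
    atomsBelow _ refl _ (inOpt (right ()) _)
  constant-guaranteed c _ (step (left ()) _)
  constant-guaranteed c _ (step (right ()) _)

  infix 5 ⟪_∣_⟫
  ⟪_∣_⟫ : Game → Game → Game
  ⟪ A ∣ B ⟫ = ⟨ opts 0 (λ _ → A) ∣ opts 0 (λ _ → B) ⟩

  ⟪∣⟫-guaranteed : ∀ {A B} → Guaranteed A → Guaranteed B → Guaranteed ⟪ A ∣ B ⟫
  ⟪∣⟫-guaranteed gA gB _ self                       = (λ _ ()) , (λ _ ())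
  ⟪∣⟫-guaranteed gA gB K (step (left  (here _)) K≤A) = gA K K≤A
  ⟪∣⟫-guaranteed gA gB K (step (right (here _)) K≤B) = gB K K≤B

  -- 0# is a junk value: with no option on that side the probe's constant is never reached.
  maxLeftOptionLs : Game → Carrier
  maxLeftOptionLs ⟨ atom _ ∣ _ ⟩   = 0#
  maxLeftOptionLs ⟨ opts n f ∣ _ ⟩ = maxF n (λ i → Ls (f i))

  minRightOptionRs : Game → Carrier
  minRightOptionRs ⟨ _ ∣ atom _ ⟩   = 0#
  minRightOptionRs ⟨ _ ∣ opts n f ⟩ = minF n (λ i → Rs (f i))

  leftProbe : Game → Game → Game
  leftProbe G Y = ⟪ Y ∣ constant (- maxLeftOptionLs G + Rs (G ⊕ Y)) ⟫

  rightProbe : Game → Game → Game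
  rightProbe H X = ⟪ constant (- minRightOptionRs H + Ls (H ⊕ X)) ∣ X ⟫

  Ls-⊕-leftProbe : ∀ G Y → Ls (G ⊕ leftProbe G Y) ≤ Rs (G ⊕ Y)
  Ls-⊕-leftProbe G@(⟨ L ∣ _ ⟩) Y = Ls-⊕-lub G moveInG (λ _ → ≤-refl)
    where
    c : Carrier
    c = - maxLeftOptionLs G + Rs (G ⊕ Y)
    moveInG : ∀ {K} → IsOptionOf K L → Rs (K ⊕ leftProbe G Y) ≤ Rs (G ⊕ Y)
    moveInG {K} (here {n} i) = begin
      Rs (K ⊕ leftProbe G Y)  ≤⟨ Rs-⊕-lb K zero ⟩
      Ls (K ⊕ constant c)     ≡⟨ Ls-⊕-constant c K ⟩
      Ls K + c                ≤⟨ +-mono-≤ c (maxF-ub n _ i) ⟩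
      maxLeftOptionLs G + c   ≡⟨ \\-leftDividesˡ _ _ ⟩
      Rs (G ⊕ Y)              ∎

  Rs-⊕-rightProbe : ∀ H X → Ls (H ⊕ X) ≤ Rs (H ⊕ rightProbe H X)
  Rs-⊕-rightProbe H@(⟨ _ ∣ R ⟩) X = Rs-⊕-glb H moveInH (λ _ → ≤-refl)
    where
    c : Carrier
    c = - minRightOptionRs H + Ls (H ⊕ X)
    moveInH : ∀ {K} → IsOptionOf K R → Ls (H ⊕ X) ≤ Ls (K ⊕ rightProbe H X)
    moveInH {K} (here {n} i) = begin
      Ls (H ⊕ X)               ≡⟨ \\-leftDividesˡ _ _ ⟨
      minRightOptionRs H + c   ≤⟨ +-mono-≤ c (minF-lb n _ i) ⟩
      Rs K + c                 ≡⟨ Rs-⊕-constant c K ⟨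
      Rs (K ⊕ constant c)      ≤⟨ Ls-⊕-ub K zero ⟩
      Ls (K ⊕ rightProbe H X)  ∎

  Ls-order⇒Rs-order : ∀ G H → (∀ X → Guaranteed X → Ls (H ⊕ X) ≤ Ls (G ⊕ X)) →
                      ∀ Y → Guaranteed Y → Rs (H ⊕ Y) ≤ Rs (G ⊕ Y)
  Ls-order⇒Rs-order G H H≤G Y gY = begin
    Rs (H ⊕ Y)              ≤⟨ Ls-⊕-ub H zero ⟩
    Ls (H ⊕ leftProbe G Y)  ≤⟨ H≤G _ (⟪∣⟫-guaranteed gY (constant-guaranteed _)) ⟩
    Ls (G ⊕ leftProbe G Y)  ≤⟨ Ls-⊕-leftProbe G Y ⟩
    Rs (G ⊕ Y)              ∎

  Rs-order⇒Ls-order : ∀ G H → (∀ Y → Guaranteed Y → Rs (H ⊕ Y) ≤ Rs (G ⊕ Y)) →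
                      ∀ X → Guaranteed X → Ls (H ⊕ X) ≤ Ls (G ⊕ X)
  Rs-order⇒Ls-order G H H≤G X gX = begin
    Ls (H ⊕ X)               ≤⟨ Rs-⊕-rightProbe H X ⟩
    Rs (H ⊕ rightProbe H X)  ≤⟨ H≤G _ (⟪∣⟫-guaranteed (constant-guaranteed _) gX) ⟩
    Rs (G ⊕ rightProbe H X)  ≤⟨ Rs-⊕-lb G zero ⟩
    Ls (G ⊕ X)               ∎

theorem19 : (ℝ : CompleteOrderedField) →
  let open CompleteOrderedField ℝ using (_≤_)
      open Games ℝ
  in (G H : Game) → Guaranteed G → Guaranteed H →
     ((∀ X → Guaranteed X → Ls (H ⊕ X) ≤ Ls (G ⊕ X)) →
        (∀ Y → Guaranteed Y → Rs (H ⊕ Y) ≤ Rs (G ⊕ Y)))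
     × ((∀ Y → Guaranteed Y → Rs (H ⊕ Y) ≤ Rs (G ⊕ Y)) →
        (∀ X → Guaranteed X → Ls (H ⊕ X) ≤ Ls (G ⊕ X)))
theorem19 ℝ G H _ _ = Ls-order⇒Rs-order G H , Rs-order⇒Ls-order G H
  where open ScoringGames ℝ
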